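{- Let $\Sigma$ be an aggregate signature, $\mathcal D$ a $\Sigma$-structure, $\Pi$ a set of defined predicates and $P$ a stratified $\Sigma(\Pi)$-aggregate program. Then the ultimate well-founded model of $P$ is two-valued, i.e. of the form $(M,M)$, and $M$ is equal to the unique ultimate stable model of $P$ and to the standard model of $P$ extending $\mathcal D$.
   Context: An aggregate signature $\Sigma$ has sorts, sorted function, predicate and aggregate symbols $\mathsf R:\{s_1\times\dots\times s_n\}\times w$; set expressions $\{(x_1,\dots,x_n)\mid\varphi\}$, aggregate atoms $\mathsf R(s,t)$ and aggregate formulas (closed under $\neg,\wedge,\vee,\forall,\exists$) are defined simultaneously; a $\Sigma$-structure $\mathcal D$ interprets aggregate symbols by relations $\mathsf R^{\mathcal D}\subseteq\mathcal P(s_1^{\mathcal D}\times\dots\times s_n^{\mathcal D})\times w^{\mathcal D}$, a set expression by its set of satisfying tuples, and $\mathsf R(s,t)$ holds iff the pair of values is in $\mathsf R^{\mathcal D}$. Programs: $\Pi$ is a set of predicate symbols not in $\Sigma$; rules are $A\leftarrow\varphi$ with $A$ a $\Pi$-atom and $\varphi$ a $\Sigma(\Pi)$-aggregate formula. Interpretations are subsets of $base_{\mathcal D}(\Pi)$ (ground $\Pi$-atoms over domain elements); $T_{P,\mathcal D}(I)$ is the set of heads of ground instances $A\leftarrow\varphi$ of rules of $P$ with $\mathcal D(I)\models\varphi$, $\mathcal D(I)$ making exactly the atoms of $I$ true. Stratified: $P$ is stratified if there is $\lambda:\Pi\to\{1,2,\dots\}$ with maximum value $m$ such that for each rule with head predicate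 $p$ and body $B$: if $q\in\Pi$ occurs in $B$ outside aggregate atoms under an even number of negations then $\lambda(q)\le\lambda(p)$, and if $q$ occurs in $B$ under an odd number of negations or inside an aggregate atom then $\lambda(q)<\lambda(p)$. With $P_i$ the rules whose head predicate has level $i$ and $\Pi_i$ the level-$i$ predicates: $\mathcal D_0=\mathcal D$, $I_i$ is the least fixpoint of the (monotone) $T_{P_i,\mathcal D_{i-1}}$ ($P_i$ seen as a program with defined predicates $\Pi_i$ over $\Sigma\cup\Pi_1\cup\dots\cup\Pi_{i-1}$ and structure $\mathcal D_{i-1}$), $\mathcal D_i=\mathcal D(I_1\cup\dots\cup I_i)$; the standard model is $I_1\cup\dots\cup I_m$. Ultimate semantics: $U(I_1,I_2)=\bigl(\bigcap_{I_1\subseteq I\subseteq I_2}T_{P,\mathcal D}(I),\ \bigcup_{I_1\subseteq I\subseteq I_2}T_{P,\mathcal D}(I)\bigr)$ for $I_1\subseteq I_2$. With components $U^1,U^2$: $U^\downarrow(b)=\mathrm{glb}\{x\subseteq b\mid U^1(x,b)\subseteq x\}$, $U^\uparrow(a)=\mathrm{glb}\{x\supseteq a\mid U^2(a,x)\subseteq x\}$, $\mathcal S(a,b)=(U^\downarrow(b),U^\uparrow(a))$. The ultimate well-founded model is the least fixpoint, in the precision order ($(a,b)\le_p(a',b')$ iff $a\subseteq a'$, $b'\subseteq b$), of $\mathcal S$ on pairs with $(a,b)\le_p U(a,b)$ and $a\subseteq U^\downarrow(b)$; ultimate stable models are the $I$ with $\mathcal S(I,I)=(I,I)$. -}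

module Defs where

open import Data.Nat using (ℕ; _≤_; _<_)
open import Data.List using (List; []; _∷_; _++_)
open import Data.List.Membership.Propositional using (_∈_)
open import Data.List.Relation.Unary.All as All using (All; []; _∷_)
open import Data.Product using (Σ; Σ-syntax; _×_; _,_; proj₁)
open import Data.Sum using (_⊎_)
open import Data.Unit using (⊤)
open import Relation.Nullary using (¬_)
open import Relation.Binary.PropositionalEquality using (_≡_)
open import Function.Bundles using (_⇔_)

record Signature : Set₁ where
  field
    Sort     : Set
    Fun      : Set
    funArgs  : Fun → List Sort
    funRes   : Fun → Sort
    Pred     : Set
    predArgs : Pred → List Sort
    -- aggregate symbol R : {s₁ × … × sₙ} × w
    Agg      : Set
    aggArgs  : Agg → List Sort
    aggVal   : Agg → Sort

record DefPreds (Sg : Signature) : Set₁ where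
  field
    DPred : Set
    dArgs : DPred → List (Signature.Sort Sg)

open DefPreds public

module _ (Sg : Signature) where
  open Signature Sg

  mutual
    data Term (Γ : List Sort) : Sort → Set where
      var : ∀ {s} → s ∈ Γ → Term Γ s
      app : (f : Fun) → Terms Γ (funArgs f) → Term Γ (funRes f)

    data Terms (Γ : List Sort) : List Sort → Set where
      []  : Terms Γ []
      _∷_ : ∀ {s ss} → Term Γ s → Terms Γ ss → Terms Γ (s ∷ ss)

module _ {Sg : Signature} where
  open Signature Sg

  -- Aggregate formulas over Σ(Π) in variable context Γ.
  -- The aggregate atom  R({(x₁,…,xₙ) | φ}, t)  is  aggAtom R φ t,
  -- where φ lives in the context Γ extended by the bound x₁ … xₙ.
  data Formula (Pi : DefPreds Sg) (Γ : List Sort) : Set where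
    atom    : (p : Pred) → Terms Sg Γ (predArgs p) → Formula Pi Γ
    defAtom : (q : DPred Pi) → Terms Sg Γ (dArgs Pi q) → Formula Pi Γ
    aggAtom : (R : Agg) → Formula Pi (aggArgs R ++ Γ) → Term Sg Γ (aggVal R) → Formula Pi Γ
    neg     : Formula Pi Γ → Formula Pi Γ
    and     : Formula Pi Γ → Formula Pi Γ → Formula Pi Γ
    or      : Formula Pi Γ → Formula Pi Γ → Formula Pi Γ
    all     : (s : Sort) → Formula Pi (s ∷ Γ) → Formula Pi Γ
    ex      : (s : Sort) → Formula Pi (s ∷ Γ) → Formula Pi Γ

  record Rule (Pi : DefPreds Sg) : Set where
    field
      ctx      : List Sort
      head     : DPred Pi
      headArgs : Terms Sg ctx (dArgs Pi head)
      body     : Formula Pi ctx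

  -- A program: a (possibly infinite) set of rules, given as an indexed family.
  record Program (Pi : DefPreds Sg) : Set₁ where
    field
      Idx  : Set
      rule : Idx → Rule Pi

open Rule public
open Program public

record Structure (Sg : Signature) : Set₁ where
  open Signature Sg
  field
    dom   : Sort → Set
    funI  : (f : Fun) → All dom (funArgs f) → dom (funRes f)
    predI : (p : Pred) → All dom (predArgs p) → Set
    -- R^D ⊆ P(s₁^D × … × sₙ^D) × w^D ; subsets represented as predicates
    aggI  : (R : Agg) → (All dom (aggArgs R) → Set) → dom (aggVal R) → Set
    -- sets are extensional: R^D only depends on the extension of the set
    aggI-ext : (R : Agg) {S S′ : All dom (aggArgs R) → Set} (v : dom (aggVal R)) →
               (∀ xs → S xs ⇔ S′ xs) → aggI R S v → aggI R S′ v

open Structure public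

appendAll : {A : Set} {P : A → Set} {xs ys : List A} → All P xs → All P ys → All P (xs ++ ys)
appendAll [] qs = qs
appendAll (p ∷ ps) qs = p ∷ appendAll ps qs

module _ {Sg : Signature} (D : Structure Sg) where
  open Signature Sg

  Env : List Sort → Set
  Env = All (dom D)

  mutual
    evalT : ∀ {Γ s} → Env Γ → Term Sg Γ s → dom D s
    evalT ρ (var x)    = All.lookup ρ x
    evalT ρ (app f ts) = funI D f (evalTs ρ ts)

    evalTs : ∀ {Γ ss} → Env Γ → Terms Sg Γ ss → All (dom D) ss
    evalTs ρ []       = []
    evalTs ρ (t ∷ ts) = evalT ρ t ∷ evalTs ρ ts

  GAtom : DefPreds Sg → Set
  GAtom Pi = Σ[ q ∈ DPred Pi ] All (dom D) (dArgs Pi q)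

  Interp : (Pi : DefPreds Sg) → Set₁
  Interp Pi = GAtom Pi → Set

  module _ {Pi : DefPreds Sg} where

    _⊆_ : Interp Pi → Interp Pi → Set
    I ⊆ J = ∀ a → I a → J a

    _≐_ : Interp Pi → Interp Pi → Set
    I ≐ J = (I ⊆ J) × (J ⊆ I)

    _∪_ : Interp Pi → Interp Pi → Interp Pi
    (I ∪ J) a = I a ⊎ J a

    sat : Interp Pi → ∀ {Γ} → Env Γ → Formula Pi Γ → Set
    sat I ρ (atom p ts)       = predI D p (evalTs ρ ts)
    sat I ρ (defAtom q ts)    = I (q , evalTs ρ ts)
    sat I ρ (aggAtom R φ t)   = aggI D R (λ xs → sat I (appendAll xs ρ) φ) (evalT ρ t)
    sat I ρ (neg φ)           = ¬ sat I ρ φ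
    sat I ρ (and φ ψ)         = sat I ρ φ × sat I ρ ψ
    sat I ρ (or φ ψ)          = sat I ρ φ ⊎ sat I ρ ψ
    sat I ρ (all s φ)         = (d : dom D s) → sat I (d ∷ ρ) φ
    sat I ρ (ex s φ)          = Σ[ d ∈ dom D s ] sat I (d ∷ ρ) φ

    headAtom : (r : Rule Pi) → Env (ctx r) → GAtom Pi
    headAtom r ρ = head r , evalTs ρ (headArgs r)

    T : Program Pi → Interp Pi → Interp Pi
    T P I a = Σ[ i ∈ Idx P ] Σ[ ρ ∈ Env (ctx (rule P i)) ]
                (headAtom (rule P i) ρ ≡ a) × sat I ρ (body (rule P i))

    -- U¹(a,b) ⊆ x   where U¹(a,b) = ⋂_{a⊆I⊆b} T(I)
    U¹⊆ : Program Pi → Interp Pi → Interp Pi → Interp Pi → Set₁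
    U¹⊆ P a b x = ∀ at → (∀ I → a ⊆ I → I ⊆ b → T P I at) → x at

    -- x ⊆ U¹(a,b)
    ⊆U¹ : Program Pi → Interp Pi → Interp Pi → Interp Pi → Set₁
    ⊆U¹ P x a b = ∀ at → x at → ∀ I → a ⊆ I → I ⊆ b → T P I at

    -- U²(a,b) ⊆ x   where U²(a,b) = ⋃_{a⊆I⊆b} T(I)
    U²⊆ : Program Pi → Interp Pi → Interp Pi → Interp Pi → Set₁
    U²⊆ P a b x = ∀ at → (Σ[ I ∈ Interp Pi ] (a ⊆ I × I ⊆ b × T P I at)) → x at

    -- c = U↓(b) = glb { x ⊆ b | U¹(x,b) ⊆ x }
    IsU↓ : Program Pi → Interp Pi → Interp Pi → Set₁
    IsU↓ P b c = ∀ at → c at ⇔ (∀ x → x ⊆ b → U¹⊆ P x b x → x at)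

    -- c = U↑(a) = glb { x ⊇ a | U²(a,x) ⊆ x }
    IsU↑ : Program Pi → Interp Pi → Interp Pi → Set₁
    IsU↑ P a c = ∀ at → c at ⇔ (∀ x → a ⊆ x → U²⊆ P a x x → x at)

    -- the pairs on which S is considered:
    -- a ⊆ b, (a,b) ≤ₚ U(a,b), a ⊆ U↓(b)
    SDom : Program Pi → Interp Pi → Interp Pi → Set₁
    SDom P a b = (a ⊆ b) × ⊆U¹ P a a b × U²⊆ P a b b
                 × (∀ c → IsU↓ P b c → a ⊆ c)

    -- S(a,b) = (a,b)
    SFix : Program Pi → Interp Pi → Interp Pi → Set₁
    SFix P a b = IsU↓ P b a × IsU↑ P a b

    _≤ₚ_ : Interp Pi × Interp Pi → Interp Pi × Interp Pi → Set
    (a , b) ≤ₚ (a′ , b′) = (a ⊆ a′) × (b′ ⊆ b)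

    IsUltWF : Program Pi → Interp Pi → Interp Pi → Set₁
    IsUltWF P a b = SDom P a b × SFix P a b
      × (∀ a′ b′ → SDom P a′ b′ → SFix P a′ b′ → (a , b) ≤ₚ (a′ , b′))

    IsUltStable : Program Pi → Interp Pi → Set₁
    IsUltStable P I = SFix P I I

data Mode : Set where
  pos negm inAgg : Mode

flip : Mode → Mode
flip pos   = negm
flip negm  = pos
flip inAgg = inAgg

module _ {Sg : Signature} {Pi : DefPreds Sg} (lvl : DPred Pi → ℕ) (n : ℕ) where
  -- occurrence condition for a body, head level n:
  -- positive (even # negations, outside aggregates): λ(q) ≤ n,
  -- otherwise (odd # negations, or inside an aggregate atom): λ(q) < n.
  StratOK : Mode → ∀ {Γ} → Formula Pi Γ → Set
  StratOK m (atom p ts)      = ⊤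
  StratOK pos (defAtom q ts)   = lvl q ≤ n
  StratOK negm (defAtom q ts)  = lvl q < n
  StratOK inAgg (defAtom q ts) = lvl q < n
  StratOK m (aggAtom R φ t)  = StratOK inAgg φ
  StratOK m (neg φ)          = StratOK (flip m) φ
  StratOK m (and φ ψ)        = StratOK m φ × StratOK m ψ
  StratOK m (or φ ψ)         = StratOK m φ × StratOK m ψ
  StratOK m (all s φ)        = StratOK m φ
  StratOK m (ex s φ)         = StratOK m φ

record Stratification {Sg : Signature} {Pi : DefPreds Sg} (P : Program Pi) : Set where
  field
    lvl     : DPred Pi → ℕ
    m       : ℕ
    lvl≥1   : ∀ q → 1 ≤ lvl q
    lvl≤m   : ∀ q → lvl q ≤ m
    ruleOK  : ∀ i → StratOK lvl (lvl (head (rule P i))) pos (body (rule P i))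

open Stratification public

module _ {Sg : Signature} (D : Structure Sg) {Pi : DefPreds Sg} {P : Program Pi}
         (st : Stratification P) where

  -- T_{P_i, D(K)}(J) with K interpreting lower strata, J the level-i atoms
  Tᵢ : ℕ → Interp D Pi → Interp D Pi
  Tᵢ i I a = Σ[ j ∈ Idx P ] (lvl st (head (rule P j)) ≡ i) ×
               Σ[ ρ ∈ Env D (ctx (rule P j)) ]
                 (headAtom D (rule P j) ρ ≡ a) × sat D I ρ (body (rule P j))

  IsLeastFixᵢ : ℕ → Interp D Pi → Interp D Pi → Set₁
  IsLeastFixᵢ i K J = _≐_ D (Tᵢ i (_∪_ D K J)) J
    × (∀ J′ → _≐_ D (Tᵢ i (_∪_ D K J′)) J′ → _⊆_ D J J′)

  Cum : (ℕ → Interp D Pi) → ℕ → Interp D Pi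
  Cum Is k a = Σ[ j ∈ ℕ ] (1 ≤ j) × (j ≤ k) × Is j a

  IsStandard : Interp D Pi → Set₁
  IsStandard M = Σ[ Is ∈ (ℕ → Interp D Pi) ]
    (∀ i → 1 ≤ i → i ≤ m st → IsLeastFixᵢ i (Cum Is (Data.Nat.pred i)) (Is i))
    × _≐_ D M (Cum Is (m st))

{-# OPTIONS --safe #-}
-- Stratification makes the body of a level-k rule monotone in the atoms of level k and
-- sensitive to atoms of lower level only through their (already fixed) truth values.
-- So each stratum is the least fixpoint of a monotone operator, and the standard model M
-- is a fixpoint of T built level by level. If (a, b) with a ⊆ b is any fixpoint of the
-- stable revision operator S, then a and b agree with M, by induction on the level: at
-- level k, b with its level-k part cut down to M is closed under U¹(·, b) and U²(a, ·),
-- hence bounds a = U↓(b) and b = U↑(a) from above, while minimality of the k-th stratum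
-- puts the level-k atoms of M into every U¹(·, b)-closed x ⊆ b, hence into a. So (M, M)
-- is the only fixpoint of S on its domain: the ultimate well-founded model and the unique
-- ultimate stable model.
module Submission where

open import Defs hiding (_∪_)
open import Level using (Level; 0ℓ) renaming (suc to lsuc)
open import Data.Product using (Σ-syntax; _×_; _,_; proj₁; proj₂)
open import Axiom.ExcludedMiddle using (ExcludedMiddle)
open import Data.Nat using (ℕ; zero; suc; pred; _≤_; _<_; s≤s)
open import Data.Nat.Properties using (≤-reflexive; m≤n⇒m≤1+n; m≤n⇒m<n∨m≡n; <-irrefl; <⇒≤; <⇒≱)
open import Data.Nat.Induction using (<-rec)
open import Data.Sum using (inj₁; inj₂; [_,_]; map₁)
open import Data.Empty using (⊥-elim)
open import Data.List.Relation.Unary.All using (_∷_)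
open import Function.Base using (_∘_)
open import Function.Bundles using (_⇔_; mk⇔; Equivalence)
open import Function.Properties.Equivalence using () renaming (sym to ⇔-sym; trans to ⇔-trans)
open import Relation.Binary.PropositionalEquality using (_≡_; refl; sym; subst)
open import Relation.Nullary.Decidable using (True; toWitness; fromWitness)
open import Relation.Unary using (Pred; ∅; _∪_; _∩_; _⊆′_; _≐′_)
open import Relation.Unary.Properties using (⊆′-refl; ⊆′-trans; ≐′-sym)

open Equivalence using (to; from)

module StratifiedMonotonicity {Sg : Signature} (D : Structure Sg) {Pi : DefPreds Sg}
                              (lvl : DPred Pi → ℕ) where

  level : GAtom D Pi → ℕ
  level at = lvl (proj₁ at)

  level-induction : (Q : Pred (GAtom D Pi) 0ℓ) →
    (∀ k → (∀ at → level at < k → Q at) → ∀ at → level at ≡ k → Q at) →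
    ∀ at → Q at
  level-induction Q step at =
    <-rec (λ k → ∀ z → level z ≡ k → Q z) (λ k ih → step k (λ z lt → ih lt z refl)) (level at) at refl

  AgreeBelow : ℕ → Interp D Pi → Interp D Pi → Set
  AgreeBelow n I J = ∀ at → level at < n → I at ⇔ J at

  agreeBelow-sym : ∀ {n I J} → AgreeBelow n I J → AgreeBelow n J I
  agreeBelow-sym I≈J at lt = ⇔-sym (I≈J at lt)

  record _⊑[_]_ (I : Interp D Pi) (n : ℕ) (J : Interp D Pi) : Set where
    field
      agree-below : AgreeBelow n I J
      ⊆-at-level  : ∀ at → level at ≡ n → I at → J at

  open _⊑[_]_ public

  agreeUpTo⇒⊑ : ∀ {n I J} → (∀ at → level at ≤ n → I at ⇔ J at) → I ⊑[ n ] J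
  agreeUpTo⇒⊑ I≈J = record
    { agree-below = λ at lt → I≈J at (<⇒≤ lt)
    ; ⊆-at-level  = λ at e → to (I≈J at (≤-reflexive e))
    }

  ≐′⇒⊑ : ∀ {n I J} → I ≐′ J → I ⊑[ n ] J
  ≐′⇒⊑ (I⊆J , J⊆I) = agreeUpTo⇒⊑ (λ at _ → mk⇔ (I⊆J at) (J⊆I at))

  sat-agreeBelow : ∀ {n Γ I J} (φ : Formula Pi Γ) → StratOK lvl n inAgg φ →
                   AgreeBelow n I J → ∀ ρ → sat D I ρ φ → sat D J ρ φ
  sat-agreeBelow (atom p ts)     ok I≈J ρ s = s
  sat-agreeBelow (defAtom q ts)  ok I≈J ρ s = to (I≈J _ ok) s
  sat-agreeBelow (aggAtom R φ t) ok I≈J ρ s =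
    aggI-ext D R _ (λ xs → mk⇔ (sat-agreeBelow φ ok I≈J _)
                               (sat-agreeBelow φ ok (agreeBelow-sym I≈J) _)) s
  sat-agreeBelow (neg φ)   ok I≈J ρ ¬s = ¬s ∘ sat-agreeBelow φ ok (agreeBelow-sym I≈J) ρ
  sat-agreeBelow (and φ ψ) (okφ , okψ) I≈J ρ (s , s′) =
    sat-agreeBelow φ okφ I≈J ρ s , sat-agreeBelow ψ okψ I≈J ρ s′
  sat-agreeBelow (or φ ψ)  (okφ , okψ) I≈J ρ (inj₁ s) = inj₁ (sat-agreeBelow φ okφ I≈J ρ s)
  sat-agreeBelow (or φ ψ)  (okφ , okψ) I≈J ρ (inj₂ s) = inj₂ (sat-agreeBelow ψ okψ I≈J ρ s)
  sat-agreeBelow (all _ φ) ok I≈J ρ s       = λ d → sat-agreeBelow φ ok I≈J (d ∷ ρ) (s d)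
  sat-agreeBelow (ex _ φ)  ok I≈J ρ (d , s) = d , sat-agreeBelow φ ok I≈J (d ∷ ρ) s

  mutual
    sat-mono : ∀ {n Γ I J} (φ : Formula Pi Γ) → StratOK lvl n pos φ →
               I ⊑[ n ] J → ∀ ρ → sat D I ρ φ → sat D J ρ φ
    sat-mono (atom p ts) ok I⊑J ρ s = s
    sat-mono (defAtom q ts) ok I⊑J ρ s with m≤n⇒m<n∨m≡n ok
    ... | inj₁ below = to (agree-below I⊑J _ below) s
    ... | inj₂ same  = ⊆-at-level I⊑J _ same s
    sat-mono (aggAtom R φ t) ok I⊑J ρ s = sat-agreeBelow (aggAtom R φ t) ok (agree-below I⊑J) ρ s
    sat-mono (neg φ)   ok I⊑J ρ ¬s = ¬s ∘ sat-antimono φ ok I⊑J ρ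
    sat-mono (and φ ψ) (okφ , okψ) I⊑J ρ (s , s′) = sat-mono φ okφ I⊑J ρ s , sat-mono ψ okψ I⊑J ρ s′
    sat-mono (or φ ψ)  (okφ , okψ) I⊑J ρ (inj₁ s) = inj₁ (sat-mono φ okφ I⊑J ρ s)
    sat-mono (or φ ψ)  (okφ , okψ) I⊑J ρ (inj₂ s) = inj₂ (sat-mono ψ okψ I⊑J ρ s)
    sat-mono (all _ φ) ok I⊑J ρ s       = λ d → sat-mono φ ok I⊑J (d ∷ ρ) (s d)
    sat-mono (ex _ φ)  ok I⊑J ρ (d , s) = d , sat-mono φ ok I⊑J (d ∷ ρ) s

    sat-antimono : ∀ {n Γ I J} (φ : Formula Pi Γ) → StratOK lvl n negm φ →
                   I ⊑[ n ] J → ∀ ρ → sat D J ρ φ → sat D I ρ φ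
    sat-antimono (atom p ts) ok I⊑J ρ s = s
    sat-antimono (defAtom q ts) ok I⊑J ρ s = from (agree-below I⊑J _ ok) s
    sat-antimono (aggAtom R φ t) ok I⊑J ρ s =
      sat-agreeBelow (aggAtom R φ t) ok (agreeBelow-sym (agree-below I⊑J)) ρ s
    sat-antimono (neg φ)   ok I⊑J ρ ¬s = ¬s ∘ sat-mono φ ok I⊑J ρ
    sat-antimono (and φ ψ) (okφ , okψ) I⊑J ρ (s , s′) =
      sat-antimono φ okφ I⊑J ρ s , sat-antimono ψ okψ I⊑J ρ s′
    sat-antimono (or φ ψ)  (okφ , okψ) I⊑J ρ (inj₁ s) = inj₁ (sat-antimono φ okφ I⊑J ρ s)
    sat-antimono (or φ ψ)  (okφ , okψ) I⊑J ρ (inj₂ s) = inj₂ (sat-antimono ψ okψ I⊑J ρ s)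
    sat-antimono (all _ φ) ok I⊑J ρ s       = λ d → sat-antimono φ ok I⊑J (d ∷ ρ) (s d)
    sat-antimono (ex _ φ)  ok I⊑J ρ (d , s) = d , sat-antimono φ ok I⊑J (d ∷ ρ) s

module ImmediateConsequence {Sg : Signature} (D : Structure Sg) {Pi : DefPreds Sg}
                              {P : Program Pi} (st : Stratification P) where

  open StratifiedMonotonicity D {Pi} (lvl st) public

  T-mono : ∀ {n I J} → I ⊑[ n ] J → ∀ at → level at ≡ n → T D P I at → T D P J at
  T-mono I⊑J _ refl (j , ρ , refl , s) =
    j , ρ , refl , sat-mono (body (rule P j)) (ruleOK st j) I⊑J ρ s

  T-cong : ∀ {I J} → I ≐′ J → T D P I ⊆′ T D P J
  T-cong I≐J at = T-mono (≐′⇒⊑ I≐J) at refl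

  Tᵢ-mono : ∀ {n I J} → I ⊑[ n ] J → Tᵢ D st n I ⊆′ Tᵢ D st n J
  Tᵢ-mono I⊑J _ (j , refl , ρ , h , s) =
    j , refl , ρ , h , sat-mono (body (rule P j)) (ruleOK st j) I⊑J ρ s

  Tᵢ-cong : ∀ {n I J} → I ≐′ J → Tᵢ D st n I ⊆′ Tᵢ D st n J
  Tᵢ-cong I≐J = Tᵢ-mono (≐′⇒⊑ I≐J)

  Tᵢ-level : ∀ {n I} at → Tᵢ D st n I at → level at ≡ n
  Tᵢ-level _ (_ , e , _ , refl , _) = e

  Tᵢ⇒T : ∀ {n I} → Tᵢ D st n I ⊆′ T D P I
  Tᵢ⇒T _ (j , _ , ρ , h , s) = j , ρ , h , s

  T⇒Tᵢ : ∀ {I} at → T D P I at → Tᵢ D st (level at) I at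
  T⇒Tᵢ _ (j , ρ , refl , s) = j , refl , ρ , refl , s

module LeastFixedPoint (lem : ExcludedMiddle (lsuc 0ℓ)) {A : Set} (S : Pred A 0ℓ)
                       (F : Pred A 0ℓ → Pred A 0ℓ) (F-into : ∀ J → F J ⊆′ S)
                       (F-mono : ∀ {J₁ J₂} → J₁ ⊆′ J₂ → J₂ ⊆′ S → F J₁ ⊆′ F J₂) where

  -- The intersection of all S-supported prefixpoints is a Set₁-valued predicate;
  -- excluded middle resizes it to Set. An inductive definition is not available, since
  -- the operators T of interest are not strictly positive.
  lfp : Pred A 0ℓ
  lfp a = True (lem {∀ (J : Pred A 0ℓ) → J ⊆′ S → F J ⊆′ J → J a})

  lfp-least : ∀ J → J ⊆′ S → F J ⊆′ J → lfp ⊆′ J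
  lfp-least J J⊆S FJ⊆J a a∈lfp = toWitness a∈lfp J J⊆S FJ⊆J

  lfp⊆S : lfp ⊆′ S
  lfp⊆S = lfp-least S ⊆′-refl (F-into S)

  lfp-prefixed : F lfp ⊆′ lfp
  lfp-prefixed a a∈F =
    fromWitness (λ J J⊆S FJ⊆J → FJ⊆J a (F-mono (lfp-least J J⊆S FJ⊆J) J⊆S a a∈F))

  lfp-postfixed : lfp ⊆′ F lfp
  lfp-postfixed = lfp-least (F lfp) (F-into lfp) (F-mono lfp-prefixed lfp⊆S)

module StandardModel (lem : ExcludedMiddle (lsuc 0ℓ)) {Sg : Signature} (D : Structure Sg)
                     {Pi : DefPreds Sg} {P : Program Pi} (st : Stratification P) where

  open ImmediateConsequence D st public

  AtLevel : ℕ → Interp D Pi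
  AtLevel n at = level at ≡ n

  stratumStep : ℕ → Interp D Pi → Interp D Pi → Interp D Pi
  stratumStep n K J = Tᵢ D st n (K ∪ J)

  stratumStep-level : ∀ n K J → stratumStep n K J ⊆′ AtLevel n
  stratumStep-level n K J = Tᵢ-level

  stratumStep-mono : ∀ n K {J₁ J₂} → J₁ ⊆′ J₂ → J₂ ⊆′ AtLevel n →
                     stratumStep n K J₁ ⊆′ stratumStep n K J₂
  stratumStep-mono n K J₁⊆J₂ J₂-at-n = Tᵢ-mono (record
    { agree-below = λ at lt → mk⇔ [ inj₁ , inj₂ ∘ J₁⊆J₂ at ]
                                  [ inj₁ , (λ j → ⊥-elim (<-irrefl (J₂-at-n at j) lt)) ]
    ; ⊆-at-level  = λ at _ → [ inj₁ , inj₂ ∘ J₁⊆J₂ at ]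
    })

  module Stratum (n : ℕ) (K : Interp D Pi) =
    LeastFixedPoint lem (AtLevel n) (stratumStep n K) (stratumStep-level n K) (stratumStep-mono n K)

  strataUpTo : ℕ → Interp D Pi
  strataUpTo zero    = ∅
  strataUpTo (suc k) = strataUpTo k ∪ Stratum.lfp (suc k) (strataUpTo k)

  stratum : ℕ → Interp D Pi
  stratum k = Stratum.lfp k (strataUpTo (pred k))

  M : Interp D Pi
  M = strataUpTo (m st)

  level-positive : ∀ at → 0 < level at
  level-positive at = lvl≥1 st (proj₁ at)

  stratum-level : ∀ k → stratum k ⊆′ AtLevel k
  stratum-level k = Stratum.lfp⊆S k (strataUpTo (pred k))

  strataUpTo-level : ∀ k at → strataUpTo k at → level at ≤ k
  strataUpTo-level (suc k) at (inj₁ s) = m≤n⇒m≤1+n (strataUpTo-level k at s)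
  strataUpTo-level (suc k) at (inj₂ s) = ≤-reflexive (stratum-level (suc k) at s)

  strataUpTo⇔stratum : ∀ k at → level at ≤ k → strataUpTo k at ⇔ stratum (level at) at
  strataUpTo⇔stratum zero at le = ⊥-elim (<⇒≱ (level-positive at) le)
  strataUpTo⇔stratum (suc k) at le with m≤n⇒m<n∨m≡n le
  ... | inj₁ (s≤s le′) = mk⇔ [ to IH , lower ] (inj₁ ∘ from IH)
    where
    IH = strataUpTo⇔stratum k at le′
    lower : stratum (suc k) at → stratum (level at) at
    lower s = ⊥-elim (<-irrefl (stratum-level (suc k) at s) (s≤s le′))
  ... | inj₂ e = mk⇔ [ higher , subst (λ j → stratum j at) (sym e) ]
                     (inj₂ ∘ subst (λ j → stratum j at) e)
    where
    higher : strataUpTo k at → stratum (level at) at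
    higher s = ⊥-elim (<-irrefl e (s≤s (strataUpTo-level k at s)))

  M⇔stratum : ∀ at → M at ⇔ stratum (level at) at
  M⇔stratum at = strataUpTo⇔stratum (m st) at (lvl≤m st (proj₁ at))

  strataBelow-level : ∀ k at → strataUpTo (pred k) at → level at < k
  strataBelow-level (suc k) at s = s≤s (strataUpTo-level k at s)

  strataBelow⇔M : ∀ k at → level at < k → strataUpTo (pred k) at ⇔ M at
  strataBelow⇔M (suc k) at (s≤s le) = ⇔-trans (strataUpTo⇔stratum k at le) (⇔-sym (M⇔stratum at))

  strataThrough⇔M : ∀ k at → level at ≤ k → (strataUpTo (pred k) ∪ stratum k) at ⇔ M at
  strataThrough⇔M k at le with m≤n⇒m<n∨m≡n le
  ... | inj₁ lt =
    mk⇔ [ to (strataBelow⇔M k at lt) , (λ s → ⊥-elim (<-irrefl (stratum-level k at s) lt)) ]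
        (inj₁ ∘ from (strataBelow⇔M k at lt))
  ... | inj₂ refl =
    mk⇔ [ (λ s → ⊥-elim (<-irrefl refl (strataBelow-level (level at) at s))) , from (M⇔stratum at) ]
        (inj₂ ∘ to (M⇔stratum at))

  M-closed : T D P M ⊆′ M
  M-closed at t = from (M⇔stratum at) (Stratum.lfp-prefixed k (strataUpTo (pred k)) at
    (T⇒Tᵢ at (T-mono (agreeUpTo⇒⊑ (λ z le → ⇔-sym (strataThrough⇔M k z le))) at refl t)))
    where k = level at

  M-supported : M ⊆′ T D P M
  M-supported at Mat = T-mono (agreeUpTo⇒⊑ (strataThrough⇔M k)) at refl
    (Tᵢ⇒T at (Stratum.lfp-postfixed k (strataUpTo (pred k)) at (to (M⇔stratum at) Mat)))
    where k = level at

  stratum-induction : ∀ k (x : Interp D Pi) →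
    (∀ I → AgreeBelow k I M → (∀ z → level z ≡ k → I z → x z) → Tᵢ D st k I ⊆′ x) →
    ∀ at → level at ≡ k → M at → x at
  stratum-induction k x closed at refl Mat =
    proj₂ (Stratum.lfp-least k K (AtLevel k ∩ x) (λ _ → proj₁) prefixed at (to (M⇔stratum at) Mat))
    where
    K = strataUpTo (pred k)
    I = K ∪ (AtLevel k ∩ x)

    I≈M : AgreeBelow k I M
    I≈M z lt = mk⇔ [ to (strataBelow⇔M k z lt) , (λ s → ⊥-elim (<-irrefl (proj₁ s) lt)) ]
                   (inj₁ ∘ from (strataBelow⇔M k z lt))

    I⊆x : ∀ z → level z ≡ k → I z → x z
    I⊆x z e (inj₁ s) = ⊥-elim (<-irrefl e (strataBelow-level k z s))
    I⊆x z e (inj₂ s) = proj₂ s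

    prefixed : stratumStep k K (AtLevel k ∩ x) ⊆′ AtLevel k ∩ x
    prefixed z t = Tᵢ-level z t , closed I I≈M I⊆x z t

  strataUpTo≐Cum : ∀ k → strataUpTo k ≐′ Cum D st stratum k
  strataUpTo≐Cum k = strataUpTo⊆Cum , Cum⊆strataUpTo
    where
    strataUpTo⊆Cum : strataUpTo k ⊆′ Cum D st stratum k
    strataUpTo⊆Cum at s = level at , level-positive at , le , to (strataUpTo⇔stratum k at le) s
      where le = strataUpTo-level k at s
    Cum⊆strataUpTo : Cum D st stratum k ⊆′ strataUpTo k
    Cum⊆strataUpTo at (j , _ , j≤k , s) with stratum-level j at s
    ... | refl = from (strataUpTo⇔stratum k at j≤k) s

  stratum-isLeastFix : ∀ i → IsLeastFixᵢ D st i (Cum D st stratum (pred i)) (stratum i)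
  stratum-isLeastFix i =
      ( ⊆′-trans (Tᵢ-cong (Cum∪≐K∪ (stratum i))) (Stratum.lfp-prefixed i K)
      , ⊆′-trans (Stratum.lfp-postfixed i K) (Tᵢ-cong (≐′-sym (Cum∪≐K∪ (stratum i)))) )
    , λ J (TJ⊆J , J⊆TJ) → Stratum.lfp-least i K J (λ z j → Tᵢ-level z (J⊆TJ z j))
                            (⊆′-trans (Tᵢ-cong (≐′-sym (Cum∪≐K∪ J))) TJ⊆J)
    where
    K = strataUpTo (pred i)

    Cum∪≐K∪ : ∀ J → (Cum D st stratum (pred i) ∪ J) ≐′ (K ∪ J)
    Cum∪≐K∪ J = (λ at → map₁ (proj₂ (strataUpTo≐Cum (pred i)) at))
              , (λ at → map₁ (proj₁ (strataUpTo≐Cum (pred i)) at))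

  M-isStandard : IsStandard D st M
  M-isStandard = stratum , (λ i _ _ → stratum-isLeastFix i) , strataUpTo≐Cum (m st)

module UltimateSemantics (lem : ExcludedMiddle (lsuc 0ℓ)) {Sg : Signature} (D : Structure Sg)
                         {Pi : DefPreds Sg} {P : Program Pi} (st : Stratification P) where

  open StandardModel lem D st public

  U¹-closed-contains-M : ∀ k (x y : Interp D Pi) → x ⊆′ y → U¹⊆ D P x y x →
    (∀ z → level z < k → M z → x z) → (∀ z → level z < k → y z → M z) →
    ∀ at → level at ≡ k → M at → x at
  U¹-closed-contains-M k x y x⊆y U¹⊆x M⊆x y⊆M = stratum-induction k x derived⊆x
    where
    derived⊆x : ∀ I → AgreeBelow k I M → (∀ z → level z ≡ k → I z → x z) → Tᵢ D st k I ⊆′ x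
    derived⊆x I I≈M I⊆x at t =
      U¹⊆x at (λ I′ x⊆I′ I′⊆y → Tᵢ⇒T at (Tᵢ-mono (I⊑I′ I′ x⊆I′ I′⊆y) at t))
      where
      I⊑I′ : ∀ I′ → x ⊆′ I′ → I′ ⊆′ y → I ⊑[ k ] I′
      I⊑I′ I′ x⊆I′ I′⊆y = record
        { agree-below = λ z lt → mk⇔ (x⊆I′ z ∘ M⊆x z lt ∘ to (I≈M z lt))
                                     (from (I≈M z lt) ∘ y⊆M z lt ∘ I′⊆y z)
        ; ⊆-at-level  = λ z e → x⊆I′ z ∘ I⊆x z e
        }

  M-U²-closed : U²⊆ D P M M M
  M-U²-closed at (I , M⊆I , I⊆M , t) = M-closed at (T-cong (I⊆M , M⊆I) at t)

  M-isU↓ : IsU↓ D P M M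
  M-isU↓ at = mk⇔ (λ Mat x x⊆M U¹⊆x → level-induction (λ z → M z → x z)
                      (λ k ih → U¹-closed-contains-M k x M x⊆M U¹⊆x ih (λ _ _ Mz → Mz)) at Mat)
                  (λ glb → glb M ⊆′-refl (λ z H → M-closed z (H M ⊆′-refl ⊆′-refl)))

  M-isU↑ : IsU↑ D P M M
  M-isU↑ at = mk⇔ (λ Mat x M⊆x _ → M⊆x at Mat) (λ glb → glb M ⊆′-refl M-U²-closed)

  M-SDom : SDom D P M M
  M-SDom = ⊆′-refl
         , (λ at Mat I M⊆I I⊆M → T-cong (M⊆I , I⊆M) at (M-supported at Mat))
         , M-U²-closed
         , λ c c-isU↓ at Mat → from (c-isU↓ at) (to (M-isU↓ at) Mat)

  module SFixpoint (a b : Interp D Pi) (a⊆b : a ⊆′ b)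
                   (a-isU↓ : IsU↓ D P b a) (b-isU↑ : IsU↑ D P a b) where

    b-U²-closed : U²⊆ D P a b b
    b-U²-closed at (I , a⊆I , I⊆b , t) = from (b-isU↑ at) λ x a⊆x U²⊆x →
      U²⊆x at (I , a⊆I , (λ z Iz → to (b-isU↑ z) (I⊆b z Iz) x a⊆x U²⊆x) , t)

    module InductionStep (k : ℕ) (a≈M : AgreeBelow k a M) (b≈M : AgreeBelow k b M) where

      cut : Interp D Pi
      cut z = (level z ≡ k → M z) × b z

      ⊆cut⇒⊑M : ∀ I → (∀ z → level z < k → M z → I z) → I ⊆′ cut → I ⊑[ k ] M
      ⊆cut⇒⊑M I M⊆I I⊆cut = record
        { agree-below = λ z lt → mk⇔ (to (b≈M z lt) ∘ proj₂ ∘ I⊆cut z) (M⊆I z lt)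
        ; ⊆-at-level  = λ z e Iz → proj₁ (I⊆cut z Iz) e
        }

      cut-U¹-closed : U¹⊆ D P cut b cut
      cut-U¹-closed z H =
          (λ e → M-closed z (T-mono (⊆cut⇒⊑M cut M⊆cut ⊆′-refl) z e (H cut ⊆′-refl (λ _ → proj₂))))
        , b-U²-closed z (b , a⊆b , ⊆′-refl , H b (λ _ → proj₂) ⊆′-refl)
        where
        M⊆cut : ∀ z → level z < k → M z → cut z
        M⊆cut z lt Mz = (λ _ → Mz) , from (b≈M z lt) Mz

      a⊆cut : a ⊆′ cut
      a⊆cut z az = to (a-isU↓ z) az cut (λ _ → proj₂) cut-U¹-closed

      cut-U²-closed : U²⊆ D P a cut cut
      cut-U²-closed z (I , a⊆I , I⊆cut , t) =
          (λ e → M-closed z (T-mono (⊆cut⇒⊑M I M⊆I I⊆cut) z e t))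
        , b-U²-closed z (I , a⊆I , (λ w → proj₂ ∘ I⊆cut w) , t)
        where
        M⊆I : ∀ w → level w < k → M w → I w
        M⊆I w lt = a⊆I w ∘ from (a≈M w lt)

      b⊆cut : b ⊆′ cut
      b⊆cut z bz = to (b-isU↑ z) bz cut a⊆cut cut-U²-closed

      M⊆a : ∀ z → level z ≡ k → M z → a z
      M⊆a z e Mz = from (a-isU↓ z) λ x x⊆b U¹⊆x →
        U¹-closed-contains-M k x b x⊆b U¹⊆x (λ w lt → a⊆x x x⊆b U¹⊆x w ∘ from (a≈M w lt))
                             (λ w lt → to (b≈M w lt)) z e Mz
        where
        a⊆x : ∀ x → x ⊆′ b → U¹⊆ D P x b x → a ⊆′ x
        a⊆x x x⊆b U¹⊆x w aw = to (a-isU↓ w) aw x x⊆b U¹⊆x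

      agree : ∀ z → level z ≡ k → (a z ⇔ M z) × (b z ⇔ M z)
      agree z e = mk⇔ (λ az → proj₁ (a⊆cut z az) e) (M⊆a z e)
                , mk⇔ (λ bz → proj₁ (b⊆cut z bz) e) (a⊆b z ∘ M⊆a z e)

    ≐M : (a ≐′ M) × (b ≐′ M)
    ≐M = ((λ z → to (proj₁ (agrees z))) , (λ z → from (proj₁ (agrees z))))
       , ((λ z → to (proj₂ (agrees z))) , (λ z → from (proj₂ (agrees z))))
      where
      agrees : ∀ z → (a z ⇔ M z) × (b z ⇔ M z)
      agrees = level-induction (λ z → (a z ⇔ M z) × (b z ⇔ M z)) λ k ih →
        InductionStep.agree k (λ z lt → proj₁ (ih z lt)) (λ z lt → proj₂ (ih z lt))

  SFix⇒≐M : ∀ a b → a ⊆′ b → SFix D P a b → (a ≐′ M) × (b ≐′ M)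
  SFix⇒≐M a b a⊆b (a-isU↓ , b-isU↑) = SFixpoint.≐M a b a⊆b a-isU↓ b-isU↑

corollary2 : (lem : ∀ {ℓ : Level} → ExcludedMiddle ℓ) →
    {Sg : Signature} (D : Structure Sg) {Pi : DefPreds Sg}
    (P : Program Pi) (st : Stratification P) →
    Σ[ M ∈ Interp D Pi ]
      ( IsUltWF D P M M
      × (∀ a b → IsUltWF D P a b → (_≐_ D a M × _≐_ D b M))
      × IsUltStable D P M
      × (∀ N → IsUltStable D P N → _≐_ D N M)
      × IsStandard D st M )
corollary2 lem D P st =
    M , (M-SDom , M-SFix , least) , unique-wf , M-SFix , unique-stable , M-isStandard
  where
  open UltimateSemantics lem D st

  M-SFix : SFix D P M M
  M-SFix = M-isU↓ , M-isU↑

  least : ∀ a b → SDom D P a b → SFix D P a b → _≤ₚ_ D (M , M) (a , b)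
  least a b (a⊆b , _) fix = let (_ , M⊆a) , (b⊆M , _) = SFix⇒≐M a b a⊆b fix in M⊆a , b⊆M

  unique-wf : ∀ a b → IsUltWF D P a b → (_≐_ D a M × _≐_ D b M)
  unique-wf a b ((a⊆b , _) , fix , _) = SFix⇒≐M a b a⊆b fix

  unique-stable : ∀ N → IsUltStable D P N → _≐_ D N M
  unique-stable N fix = proj₁ (SFix⇒≐M N N ⊆′-refl fix)
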